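{- There is a randomized algorithm which, given the vertex set $V(G)$ of a graph $G$ (whose edges are unknown), a positive integer $k$, and access to a BIS oracle for $G$, makes $\mathcal{O}(k^8\log k)$ BIS queries and, with probability at least $1-1/k^{c}$ for some constant $c>0$, correctly decides whether $G$ has a vertex cover of size at most $k$.
   Context: The BIS (bipartite independent set) oracle takes as input two disjoint non-empty subsets $A,B\subseteq V(G)$ and answers whether there exists an edge $(u,v)\in E(G)$ with $u\in A$ and $v\in B$ (yes/no only). A vertex cover is a set of vertices containing at least one endpoint of every edge. Only oracle queries are counted. -}

module Defs where

open import Data.Nat using (ℕ; zero; suc; _+_; _*_; _∸_; _^_; _≤_)
open import Data.Nat.Logarithm using (⌊log₂_⌋)
open import Data.Bool using (Bool; true; false; _∧_; _∨_)
open import Data.Fin using (Fin)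
import Data.Fin as F
open import Data.Fin.Subset using (Subset; _∈_; ∣_∣)
open import Data.Vec using (lookup)
open import Data.Product using (Σ; ∃; ∃-syntax; _×_; _,_)
open import Data.Sum using (_⊎_)
open import Data.Empty using (⊥)
open import Relation.Binary.PropositionalEquality using (_≡_)
open import Function.Bundles using (_⇔_)

record Graph (n : ℕ) : Set where
  field
    adj    : Fin n → Fin n → Bool
    sym    : ∀ u v → adj u v ≡ adj v u
    noLoop : ∀ u → adj u u ≡ false
open Graph public

Edge : ∀ {n} → Graph n → Fin n → Fin n → Set
Edge G u v = adj G u v ≡ true

IsVertexCover : ∀ {n} → Graph n → Subset n → Set
IsVertexCover G S = ∀ u v → Edge G u v → (u ∈ S) ⊎ (v ∈ S)

HasVCAtMost : ∀ {n} → Graph n → ℕ → Set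
HasVCAtMost {n} G k = ∃[ S ] (∣ S ∣ ≤ k × IsVertexCover G S)

anyFin : ∀ {n} → (Fin n → Bool) → Bool
anyFin {zero}  f = false
anyFin {suc n} f = f F.zero ∨ anyFin (λ i → f (F.suc i))

bis : ∀ {n} → Graph n → Subset n → Subset n → Bool
bis G A B = anyFin (λ u → anyFin (λ v → lookup A u ∧ lookup B v ∧ adj G u v))

Nonempty' : ∀ {n} → Subset n → Set
Nonempty' {n} A = ∃[ i ] (i ∈ A)

ValidQuery : ∀ {n} → Subset n → Subset n → Set
ValidQuery A B = Nonempty' A × Nonempty' B × (∀ i → i ∈ A → i ∈ B → ⊥)

-- Deterministic adaptive query algorithm: a decision tree of BIS queries
-- ending in a yes/no output.
data QTree (n : ℕ) : Set where
  leaf : Bool → QTree n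
  ask  : (A B : Subset n) → (Bool → QTree n) → QTree n

data ValidTree {n : ℕ} : QTree n → Set where
  leaf : ∀ b → ValidTree (leaf b)
  ask  : ∀ A B k → ValidQuery A B → (∀ b → ValidTree (k b)) → ValidTree (ask A B k)

run : ∀ {n} → Graph n → QTree n → Bool
run G (leaf b)    = b
run G (ask A B k) = run G (k (bis G A B))

queries : ∀ {n} → Graph n → QTree n → ℕ
queries G (leaf b)    = 0
queries G (ask A B k) = suc (queries G (k (bis G A B)))

-- A randomized algorithm: for each number of vertices n and parameter k,
-- a finite uniform random seed (from Fin (seeds n k)) selecting a
-- deterministic query tree.  (Any finite rational distribution is covered.)
record RandAlg : Set where
  field
    seeds : ℕ → ℕ → ℕ
    tree  : (n k : ℕ) → Fin (seeds n k) → QTree n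
open RandAlg public

Correct : ∀ {n} → Graph n → ℕ → QTree n → Set
Correct G k t = (run G t ≡ true) ⇔ HasVCAtMost G k

module Submission where

-- In each of r = ⌊log₂ k⌋ rounds draw a colouring h : V → [m],
-- m = 256 k⁴, ask one BIS query per pair of colour classes (r·m² = 65536 k⁸ ⌊log₂ k⌋
-- queries) to learn the compressed graph G/h on the colours, and accept iff every
-- G/h has a vertex cover of size ≤ k (exhaustive search).  A k-cover S of G gives the k-cover h(S) of G/h, so yes-instances are
-- always accepted.  A greedy matching yields k + 1 disjoint edges or a cover C of
-- size ≤ 2k, hence a "certificate" W, |W| ≤ 2 (k + 1)², such that any k vertices
-- covering the edges inside W force a k-cover of G; when h is injective on W a
-- k-cover of G/h pulls back to such vertices.  A random h collides on W for at most
-- a |W|²/m ≤ 1/4 fraction of colourings, so all r rounds fail for at most a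
-- 4^-r ≤ 1/k fraction of the seeds.  Probabilities are exact counts over Fin n → Fin m.

open import Defs hiding (sym)
open import Data.Nat using (ℕ; zero; suc; _+_; _*_; _∸_; _^_; _≤_; _<_; z≤n; s≤s; _≤?_; _<?_; NonZero)
open import Data.Nat.Base using (>-nonZero)
open import Data.Nat.Properties
open import Data.Nat.Logarithm using (⌊log₂_⌋; ⌊log₂⌋-mono-≤; ⌊log₂[2^n]⌋≡n)
open import Data.Nat.Solver using (module +-*-Solver)
open import Data.Bool using (Bool; true; false; _∧_; _∨_; not)
open import Data.Bool.Properties
  using (∧-conicalˡ; ∧-conicalʳ; ∨-conicalˡ; ∨-conicalʳ; not-injective; not-involutive)
import Data.Bool.Properties as Bool
open import Data.Bool.ListAction using (any)
open import Data.Fin using (Fin; _↑ˡ_; _↑ʳ_; combine; remQuot; finToFun)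
import Data.Fin as F
open import Data.Fin.Properties using (remQuot-combine; all?; any?)
open import Data.Fin.Subset using (Subset; _∈_; ∣_∣; _-_) renaming (⊥ to empty)
open import Data.Fin.Subset.Properties
  using (_∈?_; anySubset?; nonempty?; ∣⊥∣≡0; x∈p∧x≢y⇒x∈p-y; x∈p⇒∣p-x∣<∣p∣)
open import Data.Vec using (Vec; []; _∷_; here; there; lookup; tabulate)
open import Data.Vec.Properties using ([]=⇒lookup; lookup⇒[]=; lookup∘tabulate)
open import Data.Maybe using (Maybe; just; nothing)
open import Data.List using (List; []; _∷_; length; _++_; take; filter; allFin; concatMap; find)
open import Data.List.Properties using (length-++; length-take; take-all)
open import Data.List.Relation.Unary.All as All using (All; []; _∷_)
open import Data.List.Relation.Unary.AllPairs using ([]; _∷_)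
open import Data.List.Relation.Unary.Any using (here; there)
open import Data.List.Relation.Unary.Unique.Propositional using (Unique)
open import Data.List.Relation.Unary.Unique.Propositional.Properties using (allFin⁺; filter⁺; take⁺)
open import Data.List.Membership.Propositional using (lose) renaming (_∈_ to _∈L_)
open import Data.List.Membership.Propositional.Properties
  using (∈-filter⁺; ∈-filter⁻; ∈-allFin; ∈-++⁺ˡ; ∈-++⁺ʳ; ∈-concatMap⁺)
open import Data.Product using (Σ; ∃; ∃-syntax; _×_; _,_; proj₁; proj₂)
open import Data.Sum using (_⊎_; inj₁; inj₂; [_,_]′; swap)
open import Data.Empty using (⊥; ⊥-elim)
open import Function using (_∘_)
open import Function.Bundles using (mk⇔)
open import Relation.Nullary using (¬_; Dec; yes; no; does; contradiction; _×-dec_; _⊎-dec_; _→-dec_)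
open import Relation.Nullary.Decidable using (dec-true; dec-false)
open import Relation.Unary using (Decidable)
open import Relation.Binary.PropositionalEquality
open +-*-Solver

witness : ∀ {A : Set} (d : Dec A) → does d ≡ true → A
witness (yes a) _ = a

_==_ : ∀ {n} → Fin n → Fin n → Bool
x == y = does (x F.≟ y)

==-refl : ∀ {n} (x : Fin n) → (x == x) ≡ true
==-refl x = dec-true (x F.≟ x) refl

==-sound : ∀ {n} {x y : Fin n} → (x == y) ≡ true → x ≡ y
==-sound {x = x} {y} = witness (x F.≟ y)

toN : Bool → ℕ
toN true  = 1
toN false = 0

toN-∧ : ∀ a b → toN (a ∧ b) ≡ toN a * toN b
toN-∧ true  b = sym (+-identityʳ (toN b))
toN-∧ false b = refl

toN-∨ : ∀ a b → toN (a ∨ b) ≤ toN a + toN b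
toN-∨ true  b = s≤s z≤n
toN-∨ false b = ≤-refl

sumFin : ∀ {a} → (Fin a → ℕ) → ℕ
sumFin {zero}  f = 0
sumFin {suc a} f = f F.zero + sumFin (λ i → f (F.suc i))

count : ∀ {a} → (Fin a → Bool) → ℕ
count p = sumFin (λ i → toN (p i))

sumFin-cong : ∀ {a} {f g : Fin a → ℕ} → (∀ i → f i ≡ g i) → sumFin f ≡ sumFin g
sumFin-cong {zero}  e = refl
sumFin-cong {suc a} e = cong₂ _+_ (e F.zero) (sumFin-cong (λ i → e (F.suc i)))

sumFin-mono : ∀ {a} {f g : Fin a → ℕ} → (∀ i → f i ≤ g i) → sumFin f ≤ sumFin g
sumFin-mono {zero}  e = z≤n
sumFin-mono {suc a} e = +-mono-≤ (e F.zero) (sumFin-mono (λ i → e (F.suc i)))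

sumFin-+ : ∀ {a} (f g : Fin a → ℕ) → sumFin (λ i → f i + g i) ≡ sumFin f + sumFin g
sumFin-+ {zero}  f g = refl
sumFin-+ {suc a} f g =
  trans (cong (f F.zero + g F.zero +_) (sumFin-+ (λ i → f (F.suc i)) (λ i → g (F.suc i))))
        (interchange (f F.zero) (g F.zero) _ _)
  where
  interchange : ∀ a b c d → (a + b) + (c + d) ≡ (a + c) + (b + d)
  interchange = solve 4 (λ a b c d → (a :+ b) :+ (c :+ d) := (a :+ c) :+ (b :+ d)) refl

sumFin-const : ∀ {a} c → sumFin {a} (λ _ → c) ≡ a * c
sumFin-const {zero}  c = refl
sumFin-const {suc a} c = cong (c +_) (sumFin-const {a} c)

sumFin-*ˡ : ∀ {a} c (f : Fin a → ℕ) → sumFin (λ i → c * f i) ≡ c * sumFin f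
sumFin-*ˡ {zero}  c f = sym (*-zeroʳ c)
sumFin-*ˡ {suc a} c f =
  trans (cong (c * f F.zero +_) (sumFin-*ˡ c (λ i → f (F.suc i))))
        (sym (*-distribˡ-+ c (f F.zero) _))

sumFin-↑ : ∀ b {c} (f : Fin (b + c) → ℕ) →
           sumFin f ≡ sumFin (λ y → f (y ↑ˡ c)) + sumFin (λ z → f (b ↑ʳ z))
sumFin-↑ zero    f = refl
sumFin-↑ (suc b) f = trans (cong (f F.zero +_) (sumFin-↑ b (λ i → f (F.suc i))))
                           (sym (+-assoc (f F.zero) _ _))

sumFin-combine : ∀ a b (f : Fin (a * b) → ℕ) →
                 sumFin f ≡ sumFin {a} (λ x → sumFin {b} (λ y → f (combine x y)))
sumFin-combine zero    b f = refl
sumFin-combine (suc a) b f =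
  trans (sumFin-↑ b {a * b} f)
        (cong (sumFin (λ y → f (y ↑ˡ (a * b))) +_) (sumFin-combine a b (λ z → f (b ↑ʳ z))))

sumFin-pairs : ∀ a b (g : Fin a × Fin b → ℕ) →
               sumFin {a * b} (λ i → g (remQuot b i)) ≡ sumFin (λ x → sumFin (λ y → g (x , y)))
sumFin-pairs a b g = trans (sumFin-combine a b _)
  (sumFin-cong (λ x → sumFin-cong (λ y → cong g (remQuot-combine x y))))

sumFin-swap : ∀ a b (f : Fin a → Fin b → ℕ) →
              sumFin (λ x → sumFin (λ y → f x y)) ≡ sumFin (λ y → sumFin (λ x → f x y))
sumFin-swap zero    b f = sym (trans (sumFin-const {b} 0) (*-zeroʳ b))
sumFin-swap (suc a) b f =
  trans (cong (sumFin (f F.zero) +_) (sumFin-swap a b (λ x → f (F.suc x))))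
        (sym (sumFin-+ (f F.zero) (λ y → sumFin (λ x → f (F.suc x) y))))

count-false : ∀ {N} → count {N} (λ _ → false) ≡ 0
count-false {N} = trans (sumFin-const {N} 0) (*-zeroʳ N)

count-==ˡ : ∀ {a} (c : Fin a) → count (λ x → x == c) ≡ 1
count-==ˡ {suc a} F.zero    = cong suc (count-false {a})
count-==ˡ {suc a} (F.suc c) = count-==ˡ c

count-==ʳ : ∀ {a} (c : Fin a) → count (λ x → c == x) ≡ 1
count-==ʳ {suc a} F.zero    = cong suc (count-false {a})
count-==ʳ {suc a} (F.suc c) = count-==ʳ c

count-∨ : ∀ {N} (f g : Fin N → Bool) → count (λ j → f j ∨ g j) ≤ count f + count g
count-∨ f g = ≤-trans (sumFin-mono (λ j → toN-∨ (f j) (g j)))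
                      (≤-reflexive (sumFin-+ (λ j → toN (f j)) (λ j → toN (g j))))

count-not : ∀ {N} (p : Fin N → Bool) → count p + count (λ i → not (p i)) ≡ N
count-not {N} p = trans (sym (sumFin-+ (λ i → toN (p i)) (λ i → toN (not (p i)))))
  (trans (sumFin-cong (λ i → excluded-middle (p i))) (trans (sumFin-const {N} 1) (*-identityʳ N)))
  where
  excluded-middle : ∀ b → toN b + toN (not b) ≡ 1
  excluded-middle true  = refl
  excluded-middle false = refl

∣tabulate∣ : ∀ {N} (p : Fin N → Bool) → ∣ tabulate p ∣ ≡ count p
∣tabulate∣ {zero}  p = refl
∣tabulate∣ {suc N} p with p F.zero
... | true  = cong suc (∣tabulate∣ (λ i → p (F.suc i)))
... | false = ∣tabulate∣ (λ i → p (F.suc i))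

everyFin : ∀ {n} → (Fin n → Bool) → Bool
everyFin {zero}  f = true
everyFin {suc n} f = f F.zero ∧ everyFin (λ i → f (F.suc i))

anyFin-sound : ∀ {n} (f : Fin n → Bool) → anyFin f ≡ true → ∃ λ i → f i ≡ true
anyFin-sound {suc n} f e with f F.zero in eq
... | true  = F.zero , eq
... | false with anyFin-sound (λ i → f (F.suc i)) e
...   | i , p = F.suc i , p

anyFin-complete : ∀ {n} (f : Fin n → Bool) i → f i ≡ true → anyFin f ≡ true
anyFin-complete f F.zero e rewrite e = refl
anyFin-complete f (F.suc i) e with f F.zero
... | true  = refl
... | false = anyFin-complete (λ i → f (F.suc i)) i e

everyFin-sound : ∀ {n} (f : Fin n → Bool) → everyFin f ≡ true → ∀ i → f i ≡ true
everyFin-sound f e F.zero    = ∧-conicalˡ (f F.zero) _ e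
everyFin-sound f e (F.suc i) = everyFin-sound (λ i → f (F.suc i)) (∧-conicalʳ (f F.zero) _ e) i

everyFin-complete : ∀ {n} (f : Fin n → Bool) → (∀ i → f i ≡ true) → everyFin f ≡ true
everyFin-complete {zero}  f h = refl
everyFin-complete {suc n} f h
  rewrite h F.zero = everyFin-complete (λ i → f (F.suc i)) (λ i → h (F.suc i))

everyFin-false : ∀ {n} (f : Fin n → Bool) → everyFin f ≡ false → ∃ λ i → f i ≡ false
everyFin-false {suc n} f e with f F.zero in eq
... | false = F.zero , eq
... | true with everyFin-false (λ i → f (F.suc i)) e
...   | i , p = F.suc i , p

any-false : ∀ {X : Set} (f : X → Bool) {x} xs → any f xs ≡ false → x ∈L xs → f x ≡ false
any-false f (y ∷ xs) e (here refl) = ∨-conicalˡ (f y) _ e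
any-false f (y ∷ xs) e (there x∈) = any-false f xs (∨-conicalʳ (f y) _ e) x∈

one-per-column : ∀ a b (test : Fin a → Fin b → Bool) → (∀ y → count (λ x → test x y) ≡ 1) →
  count {a * b} (λ i → test (proj₁ (remQuot {a} b i)) (proj₂ (remQuot {a} b i))) ≡ b
one-per-column a b test once =
  trans (sumFin-pairs a b (λ p → toN (test (proj₁ p) (proj₂ p))))
  (trans (sumFin-swap a b _) (trans (sumFin-cong once) (trans (sumFin-const {b} 1) (*-identityʳ b))))

collisions : ∀ m n {u v : Fin n} → ¬ u ≡ v →
  count {m ^ n} (λ i → finToFun i u == finToFun i v) * m ≡ m ^ n
collisions m (suc n) {F.zero} {F.zero} u≢v = ⊥-elim (u≢v refl)
collisions m (suc n) {F.zero} {F.suc v} _ =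
  trans (cong (_* m) (one-per-column m (m ^ n) (λ x y → x == finToFun y v) (λ y → count-==ˡ (finToFun y v))))
        (*-comm (m ^ n) m)
collisions m (suc n) {F.suc u} {F.zero} _ =
  trans (cong (_* m) (one-per-column m (m ^ n) (λ x y → finToFun y u == x) (λ y → count-==ʳ (finToFun y u))))
        (*-comm (m ^ n) m)
collisions m (suc n) {F.suc u} {F.suc v} su≢sv =
  begin
    count {m * m ^ n} (λ i → collide (proj₂ (remQuot {m} (m ^ n) i))) * m
  ≡⟨ cong (_* m) (sumFin-pairs m (m ^ n) (λ p → toN (collide (proj₂ p)))) ⟩
    sumFin {m} (λ _ → count collide) * m
  ≡⟨ cong (_* m) (sumFin-const {m} _) ⟩
    m * count collide * m
  ≡⟨ *-assoc m _ m ⟩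
    m * (count collide * m)
  ≡⟨ cong (m *_) (collisions m n (λ u≡v → su≢sv (cong F.suc u≡v))) ⟩
    m * m ^ n
  ∎
  where
  open ≡-Reasoning
  collide : Fin (m ^ n) → Bool
  collide y = finToFun y u == finToFun y v

count-every : ∀ M r (p : Fin M → Bool) →
  count {M ^ r} (λ i → everyFin (λ t → p (finToFun {M} {r} i t))) ≡ count p ^ r
count-every M zero    p = refl
count-every M (suc r) p =
  begin
    count {M * M ^ r} (λ i → p (proj₁ (remQuot {M} (M ^ r) i)) ∧ rest (proj₂ (remQuot {M} (M ^ r) i)))
  ≡⟨ sumFin-pairs M (M ^ r) (λ q → toN (p (proj₁ q) ∧ rest (proj₂ q))) ⟩
    sumFin (λ x → sumFin (λ y → toN (p x ∧ rest y)))
  ≡⟨ sumFin-cong (λ x → trans (sumFin-cong (λ y → toN-∧ (p x) (rest y)))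
                              (sumFin-*ˡ (toN (p x)) (λ y → toN (rest y)))) ⟩
    sumFin (λ x → toN (p x) * count rest)
  ≡⟨ sumFin-cong (λ x → *-comm (toN (p x)) (count rest)) ⟩
    sumFin (λ x → count rest * toN (p x))
  ≡⟨ sumFin-*ˡ (count rest) (λ x → toN (p x)) ⟩
    count rest * count p
  ≡⟨ *-comm (count rest) (count p) ⟩
    count p * count rest
  ≡⟨ cong (count p *_) (count-every M r p) ⟩
    count p * count p ^ r
  ∎
  where
  open ≡-Reasoning
  rest : Fin (M ^ r) → Bool
  rest i = everyFin (λ t → p (finToFun {M} {r} i t))

union-bound : ∀ {X : Set} {N} (xs : List X) (P : X → Fin N → Bool) m B →
  (∀ x → count (P x) * m ≤ B) → count (λ j → any (λ x → P x j) xs) * m ≤ length xs * B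
union-bound {N = N} [] P m B h = ≤-reflexive (cong (_* m) (count-false {N}))
union-bound (x ∷ xs) P m B h =
  ≤-trans (*-monoˡ-≤ m (count-∨ (P x) (λ j → any (λ x → P x j) xs)))
  (≤-trans (≤-reflexive (*-distribʳ-+ m (count (P x)) _)) (+-mono-≤ (h x) (union-bound xs P m B h)))

distinct≤ : ∀ {n} (xs : List (Fin n)) (T : Subset n) → Unique xs → All (_∈ T) xs →
            length xs ≤ ∣ T ∣
distinct≤ []       T _              _              = z≤n
distinct≤ (x ∷ xs) T (x∉xs ∷ xs-uniq) (x∈T ∷ xs⊆T) =
  ≤-trans (s≤s (distinct≤ xs (T - x) xs-uniq xs⊆T-x)) (x∈p⇒∣p-x∣<∣p∣ x∈T)
  where
  xs⊆T-x : All (_∈ T - x) xs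
  xs⊆T-x = All.zipWith (λ (y∈T , x≢y) → x∈p∧x≢y⇒x∈p-y y∈T (≢-sym x≢y)) (xs⊆T , x∉xs)

endpoints : ∀ {n} → List (Fin n × Fin n) → List (Fin n)
endpoints []             = []
endpoints ((u , v) ∷ ms) = u ∷ v ∷ endpoints ms

length-endpoints : ∀ {n} (ms : List (Fin n × Fin n)) → length (endpoints ms) ≡ 2 * length ms
length-endpoints []             = refl
length-endpoints ((u , v) ∷ ms) = trans (cong (suc ∘ suc) (length-endpoints ms)) (sym (*-suc 2 (length ms)))

Touches : ∀ {n} → Subset n → Fin n × Fin n → Set
Touches T (u , v) = u ∈ T ⊎ v ∈ T

touches-without : ∀ {n} {x : Fin n} {T} ms → All (x ≢_) (endpoints ms) →
                  All (Touches T) ms → All (Touches (T - x)) ms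
touches-without [] _ [] = []
touches-without ((a , b) ∷ ms) (x≢a ∷ x≢b ∷ rest) (inj₁ a∈T ∷ ts) =
  inj₁ (x∈p∧x≢y⇒x∈p-y a∈T (≢-sym x≢a)) ∷ touches-without ms rest ts
touches-without ((a , b) ∷ ms) (x≢a ∷ x≢b ∷ rest) (inj₂ b∈T ∷ ts) =
  inj₂ (x∈p∧x≢y⇒x∈p-y b∈T (≢-sym x≢b)) ∷ touches-without ms rest ts

matching≤ : ∀ {n} ms (T : Subset n) → Unique (endpoints ms) → All (Touches T) ms →
            length ms ≤ ∣ T ∣
matching≤ [] T _ _ = z≤n
matching≤ ((u , v) ∷ ms) T ((_ ∷ u∉ms) ∷ v∉ms ∷ ms-uniq) (inj₁ u∈T ∷ ts) =
  ≤-trans (s≤s (matching≤ ms (T - u) ms-uniq (touches-without ms u∉ms ts))) (x∈p⇒∣p-x∣<∣p∣ u∈T)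
matching≤ ((u , v) ∷ ms) T ((_ ∷ u∉ms) ∷ v∉ms ∷ ms-uniq) (inj₂ v∈T ∷ ts) =
  ≤-trans (s≤s (matching≤ ms (T - v) ms-uniq (touches-without ms v∉ms ts))) (x∈p⇒∣p-x∣<∣p∣ v∈T)

add : ∀ {n} → Fin n → Subset n → Subset n
add F.zero    (_ ∷ T) = true ∷ T
add (F.suc i) (b ∷ T) = b ∷ add i T

∣add∣ : ∀ {n} (i : Fin n) T → ∣ add i T ∣ ≤ suc ∣ T ∣
∣add∣ F.zero    (true  ∷ T) = n≤1+n _
∣add∣ F.zero    (false ∷ T) = ≤-refl
∣add∣ (F.suc i) (true  ∷ T) = s≤s (∣add∣ i T)
∣add∣ (F.suc i) (false ∷ T) = ∣add∣ i T

∈add-new : ∀ {n} (i : Fin n) T → i ∈ add i T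
∈add-new F.zero    (_ ∷ T) = here
∈add-new (F.suc i) (_ ∷ T) = there (∈add-new i T)

∈add-old : ∀ {n} (i : Fin n) {j} T → j ∈ T → j ∈ add i T
∈add-old F.zero    (_ ∷ T) here      = here
∈add-old F.zero    (_ ∷ T) (there p) = there p
∈add-old (F.suc i) (_ ∷ T) here      = here
∈add-old (F.suc i) (_ ∷ T) (there p) = there (∈add-old i T p)

addMaybe : ∀ {n} → Maybe (Fin n) → Subset n → Subset n
addMaybe nothing  T = T
addMaybe (just y) T = add y T

image : ∀ {a b} → (Fin a → Maybe (Fin b)) → Subset a → Subset b
image {zero}  f []          = empty
image {suc a} f (true  ∷ S) = addMaybe (f F.zero) (image (λ i → f (F.suc i)) S)
image {suc a} f (false ∷ S) = image (λ i → f (F.suc i)) S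

∣image∣ : ∀ {a b} (f : Fin a → Maybe (Fin b)) S → ∣ image f S ∣ ≤ ∣ S ∣
∣image∣ {zero} {b} f [] = ≤-reflexive (∣⊥∣≡0 b)
∣image∣ {suc a} f (false ∷ S) = ∣image∣ (λ i → f (F.suc i)) S
∣image∣ {suc a} f (true ∷ S) with f F.zero
... | nothing = m≤n⇒m≤1+n (∣image∣ (λ i → f (F.suc i)) S)
... | just y  = ≤-trans (∣add∣ y _) (s≤s (∣image∣ (λ i → f (F.suc i)) S))

∈image : ∀ {a b} (f : Fin a → Maybe (Fin b)) S {x y} → x ∈ S → f x ≡ just y → y ∈ image f S
∈image f (true ∷ S) {F.zero} {y} here fx≡y rewrite fx≡y = ∈add-new y _
∈image f (true ∷ S) {F.suc x} (there x∈S) fx≡y = old (f F.zero) (∈image (λ i → f (F.suc i)) S x∈S fx≡y)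
  where
  old : ∀ my {j T} → j ∈ T → j ∈ addMaybe my T
  old nothing  j∈T = j∈T
  old (just z) j∈T = ∈add-old z _ j∈T
∈image f (false ∷ S) {F.suc x} (there x∈S) fx≡y = ∈image (λ i → f (F.suc i)) S x∈S fx≡y

HasCover : ∀ {m} → (Fin m → Fin m → Bool) → ℕ → Set
HasCover {m} H k = ∃[ T ] (∣ T ∣ ≤ k × (∀ a b → H a b ≡ true → a ∈ T ⊎ b ∈ T))

cover? : ∀ {m} (H : Fin m → Fin m → Bool) k → Dec (HasCover H k)
cover? H k = anySubset? (λ T → (∣ T ∣ ≤? k) ×-dec
  all? (λ a → all? (λ b → (H a b Bool.≟ true) →-dec ((a ∈? T) ⊎-dec (b ∈? T)))))

HasCover-cong : ∀ {m} {H H′ : Fin m → Fin m → Bool} k → (∀ a b → H a b ≡ H′ a b) →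
                HasCover H k → HasCover H′ k
HasCover-cong k H≡H′ (T , ∣T∣≤k , covers) = T , ∣T∣≤k , λ a b e → covers a b (trans (H≡H′ a b) e)

IsMatching : ∀ {n} → (Fin n → Fin n → Bool) → List (Fin n × Fin n) → Set
IsMatching E ms = Unique (endpoints ms) × All (λ e → E (proj₁ e) (proj₂ e) ≡ true) ms

Covers : ∀ {n} → (Fin n → Fin n → Bool) → List (Fin n) → Set
Covers E C = ∀ u v → E u v ≡ true → u ∈L C ⊎ v ∈L C

avoids : ∀ {n} → Fin n → Fin n → Fin n → Bool
avoids a b z = not (z == a) ∧ not (z == b)

delete2 : ∀ {n} → Fin n → Fin n → (Fin n → Fin n → Bool) → Fin n → Fin n → Bool
delete2 a b E x y = E x y ∧ (avoids a b x ∧ avoids a b y)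

survivor : ∀ {n} {a b x : Fin n} → avoids a b x ≡ true → ¬ a ≡ x × ¬ b ≡ x
survivor {a = a} {b} {x} e =
  (λ { refl → self-distinct (∧-conicalˡ _ _ e) }) ,
  (λ { refl → self-distinct (∧-conicalʳ (not (x == a)) _ e) })
  where
  self-distinct : not (x == x) ≡ true → ⊥
  self-distinct rewrite ==-refl x = λ ()

survivors : ∀ {n} {E} {a b : Fin n} ms → All (λ e → delete2 a b E (proj₁ e) (proj₂ e) ≡ true) ms →
            All (λ x → ¬ a ≡ x × ¬ b ≡ x) (endpoints ms)
survivors [] [] = []
survivors {E = E} {a} {b} ((x , y) ∷ ms) (exy ∷ es) =
  survivor (∧-conicalˡ (avoids a b x) _ kept-xy) ∷
  survivor (∧-conicalʳ (avoids a b x) _ kept-xy) ∷ survivors {E = E} ms es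
  where
  kept-xy : avoids a b x ∧ avoids a b y ≡ true
  kept-xy = ∧-conicalʳ (E x y) _ exy

extend-matching : ∀ {n} {E} {a b : Fin n} → ¬ a ≡ b → E a b ≡ true →
                  ∀ ms → IsMatching (delete2 a b E) ms → IsMatching E ((a , b) ∷ ms)
extend-matching {E = E} a≢b eab ms (uniq , edges) =
  ((a≢b ∷ All.map proj₁ avoid) ∷ All.map proj₂ avoid ∷ uniq) ,
  eab ∷ All.map (λ {e} → ∧-conicalˡ (E (proj₁ e) (proj₂ e)) _) edges
  where avoid = survivors {E = E} ms edges

extend-cover : ∀ {n} {E} {a b : Fin n} C → Covers (delete2 a b E) C → Covers E (a ∷ b ∷ C)
extend-cover {E = E} {a} {b} C covers u v e
  with u F.≟ a | u F.≟ b | v F.≟ a | v F.≟ b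
... | yes u≡a | _       | _       | _       = inj₁ (here u≡a)
... | no _    | yes u≡b | _       | _       = inj₁ (there (here u≡b))
... | no _    | no _    | yes v≡a | _       = inj₂ (here v≡a)
... | no _    | no _    | no _    | yes v≡b = inj₂ (there (here v≡b))
... | no u≢a  | no u≢b  | no v≢a  | no v≢b  with covers u v deleted-edge
  where
  deleted-edge : delete2 a b E u v ≡ true
  deleted-edge rewrite e | dec-false (u F.≟ a) u≢a | dec-false (u F.≟ b) u≢b
                         | dec-false (v F.≟ a) v≢a | dec-false (v F.≟ b) v≢b = refl
...   | inj₁ u∈C = inj₁ (there (there u∈C))
...   | inj₂ v∈C = inj₂ (there (there v∈C))

ends-distinct : ∀ {n} {E : Fin n → Fin n → Bool} {a b} → (∀ x → E x x ≡ false) → E a b ≡ true → ¬ a ≡ b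
ends-distinct loopless eab refl with () ← trans (sym eab) (loopless _)

delete2-loopless : ∀ {n} {E : Fin n → Fin n → Bool} a b → (∀ x → E x x ≡ false) →
                   ∀ x → delete2 a b E x x ≡ false
delete2-loopless a b loopless x rewrite loopless x = refl

matching-or-cover : ∀ {n} k (E : Fin n → Fin n → Bool) → (∀ x → E x x ≡ false) →
  (∃[ ms ] (length ms ≡ suc k × IsMatching E ms)) ⊎ (∃[ C ] (length C ≤ 2 * k × Covers E C))
matching-or-cover k E loopless with any? (λ u → any? (λ v → E u v Bool.≟ true))
... | no no-edge = inj₂ ([] , z≤n , λ u v e → ⊥-elim (no-edge (u , v , e)))
... | yes (a , b , eab) with k
...   | zero = inj₁ ((a , b) ∷ [] , refl , extend-matching {E = E} (ends-distinct loopless eab) eab [] ([] , []))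
...   | suc k′ with matching-or-cover k′ (delete2 a b E) (delete2-loopless {E = E} a b loopless)
...     | inj₁ (ms , len , M) =
  inj₁ ((a , b) ∷ ms , cong suc len , extend-matching {E = E} (ends-distinct loopless eab) eab ms M)
...     | inj₂ (C , len , covers) =
  inj₂ (a ∷ b ∷ C , ≤-trans (s≤s (s≤s len)) (≤-reflexive (sym (*-suc 2 k′))) , extend-cover {E = E} C covers)

CoversInside : ∀ {n} → Graph n → List (Fin n) → Subset n → Set
CoversInside G W T = ∀ u v → u ∈L W → v ∈L W → Edge G u v → u ∈ T ⊎ v ∈ T

Certificate : ∀ {n} → Graph n → ℕ → List (Fin n) → Set
Certificate G k W = ∀ T → ∣ T ∣ ≤ k → CoversInside G W T → HasVCAtMost G k

edges-inside : ∀ {n} ms {W : List (Fin n)} → (∀ {x} → x ∈L endpoints ms → x ∈L W) →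
               All (λ e → proj₁ e ∈L W × proj₂ e ∈L W) ms
edges-inside []             sub = []
edges-inside ((u , v) ∷ ms) sub =
  (sub (here refl) , sub (there (here refl))) ∷ edges-inside ms (λ x∈ → sub (there (there x∈)))

-- A matching of k + 1 edges is a certificate, vacuously: no k vertices meet all its edges.
matching-certificate : ∀ {n} (G : Graph n) k ms → length ms ≡ suc k → IsMatching (adj G) ms →
                       Certificate G k (endpoints ms)
matching-certificate G k ms len (uniq , edges) T ∣T∣≤k covers =
  ⊥-elim (<⇒≱ (s≤s ∣T∣≤k) (subst (_≤ ∣ T ∣) len (matching≤ ms T uniq touched)))
  where
  touched : All (Touches T) ms
  touched = All.zipWith (λ { {u , v} ((u∈ , v∈) , e) → covers u v u∈ v∈ e })
                        (edges-inside ms (λ x∈ → x∈) , edges)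

∈-take : ∀ {A : Set} n (xs : List A) {y} → y ∈L take n xs → y ∈L xs
∈-take (suc n) (x ∷ xs) (here y≡x) = here y≡x
∈-take (suc n) (x ∷ xs) (there y∈) = there (∈-take n xs y∈)

module Kernel {n} (G : Graph n) (k : ℕ) (C : List (Fin n)) where

  neighbours : Fin n → List (Fin n)
  neighbours x = filter (λ v → adj G x v Bool.≟ true) (allFin n)

  sample : Fin n → List (Fin n)
  sample x = take (suc k) (neighbours x)

  W : List (Fin n)
  W = C ++ concatMap sample C

  ∈W-sampled : ∀ {x y} → x ∈L C → y ∈L sample x → y ∈L W
  ∈W-sampled x∈C y∈ = ∈-++⁺ʳ C (∈-concatMap⁺ sample (lose x∈C y∈))

  ∣W∣ : length C ≤ 2 * k → length W ≤ 2 * (suc k * suc k)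
  ∣W∣ ∣C∣≤2k = begin
      length (C ++ concatMap sample C)         ≡⟨ length-++ C ⟩
      length C + length (concatMap sample C)   ≤⟨ +-monoʳ-≤ (length C) (samples C) ⟩
      length C + length C * suc k              ≤⟨ +-mono-≤ ∣C∣≤2k (*-monoˡ-≤ (suc k) ∣C∣≤2k) ⟩
      2 * k + 2 * k * suc k                    ≤⟨ m≤m+n _ 2 ⟩
      2 * k + 2 * k * suc k + 2                ≡⟨ square k ⟩
      2 * (suc k * suc k)                      ∎
    where
    open ≤-Reasoning
    samples : ∀ xs → length (concatMap sample xs) ≤ length xs * suc k
    samples []       = z≤n
    samples (x ∷ xs) = begin
      length (sample x ++ concatMap sample xs)  ≡⟨ length-++ (sample x) ⟩
      length (sample x) + length (concatMap sample xs)
        ≤⟨ +-mono-≤ (≤-trans (≤-reflexive (length-take (suc k) (neighbours x))) (m⊓n≤m (suc k) _))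
                    (samples xs) ⟩
      suc k + length xs * suc k                 ∎
    square : ∀ k → 2 * k + 2 * k * suc k + 2 ≡ 2 * (suc k * suc k)
    square = solve 1 (λ k → con 2 :* k :+ con 2 :* k :* (con 1 :+ k) :+ con 2
                          := con 2 :* ((con 1 :+ k) :* (con 1 :+ k))) refl

  module _ (T : Subset n) (∣T∣≤k : ∣ T ∣ ≤ k) (covers : CoversInside G W T) where

    -- A vertex of C with more than k neighbours lies in every small cover of G[W]:
    -- otherwise its k + 1 sampled neighbours would all have to lie in T.
    high-degree : ∀ {x} → x ∈L C → suc k ≤ length (neighbours x) → x ∈ T
    high-degree {x} x∈C deg with x ∈? T
    ... | yes x∈T = x∈T
    ... | no  x∉T = ⊥-elim (<⇒≱ (s≤s ∣T∣≤k) (subst (_≤ ∣ T ∣) ∣sample∣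
            (distinct≤ (sample x) T (take⁺ (suc k) (filter⁺ _ (allFin⁺ n))) (All.tabulate sampled∈T))))
      where
      ∣sample∣ : length (sample x) ≡ suc k
      ∣sample∣ = trans (length-take (suc k) (neighbours x)) (m≤n⇒m⊓n≡m deg)
      sampled∈T : ∀ {w} → w ∈L sample x → w ∈ T
      sampled∈T {w} w∈ with covers x w (∈-++⁺ˡ x∈C) (∈W-sampled x∈C w∈)
                          (proj₂ (∈-filter⁻ _ {xs = allFin n} (∈-take (suc k) (neighbours x) w∈)))
      ... | inj₁ x∈T = ⊥-elim (x∉T x∈T)
      ... | inj₂ w∈T = w∈T

    low-degree : ∀ {x y} → x ∈L C → length (neighbours x) ≤ k → Edge G x y → y ∈L W
    low-degree {x} {y} x∈C deg e = ∈W-sampled x∈C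
      (subst (y ∈L_) (sym (take-all (suc k) (neighbours x) (m≤n⇒m≤1+n deg)))
             (∈-filter⁺ _ (∈-allFin y) e))

    covers-at-C : ∀ {x y} → x ∈L C → Edge G x y → x ∈ T ⊎ y ∈ T
    covers-at-C {x} {y} x∈C e with suc k ≤? length (neighbours x)
    ... | yes high = inj₁ (high-degree x∈C high)
    ... | no  low  = covers x y (∈-++⁺ˡ x∈C) (low-degree x∈C (≤-pred (≰⇒> low)) e) e

  cover-certificate : Covers (adj G) C → Certificate G k W
  cover-certificate C-covers T ∣T∣≤k covers = T , ∣T∣≤k , λ u v e →
    [ (λ u∈C → covers-at-C T ∣T∣≤k covers u∈C e)
    , (λ v∈C → swap (covers-at-C T ∣T∣≤k covers v∈C (trans (Graph.sym G v u) e))) ]′ (C-covers u v e)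

kernel : ∀ {n} (G : Graph n) k → ∃[ W ] (length W ≤ 2 * (suc k * suc k) × Certificate G k W)
kernel G k with matching-or-cover k (adj G) (noLoop G)
... | inj₁ (ms , len , M) =
  endpoints ms ,
  ≤-trans (≤-reflexive (trans (length-endpoints ms) (cong (2 *_) len))) (*-monoʳ-≤ 2 (m≤m*n (suc k) (suc k))) ,
  matching-certificate G k ms len M
... | inj₂ (C , ∣C∣≤2k , C-covers) = W , ∣W∣ ∣C∣≤2k , cover-certificate C-covers
  where open Kernel G k C

bis-sound : ∀ {n} (G : Graph n) A B → bis G A B ≡ true →
            ∃ λ u → ∃ λ v → u ∈ A × v ∈ B × Edge G u v
bis-sound G A B e with anyFin-sound _ e
... | u , e₁ with anyFin-sound _ e₁
...   | v , e₂ = u , v , lookup⇒[]= u A (∧-conicalˡ _ _ e₂)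
                       , lookup⇒[]= v B (∧-conicalˡ _ _ (∧-conicalʳ (lookup A u) _ e₂))
                       , ∧-conicalʳ _ _ (∧-conicalʳ (lookup A u) _ e₂)

bis-complete : ∀ {n} (G : Graph n) A B u v → u ∈ A → v ∈ B → Edge G u v → bis G A B ≡ true
bis-complete G A B u v u∈A v∈B e =
  anyFin-complete _ u (anyFin-complete _ v (both ([]=⇒lookup u∈A) (both ([]=⇒lookup v∈B) e)))
  where
  both : ∀ {a b} → a ≡ true → b ≡ true → a ∧ b ≡ true
  both refl refl = refl

-- A valid BIS query, and a batch of N optional queries asked non-adaptively:
-- `batch q k` asks every present query q x in turn and hands the vector of
-- answers (false for an absent query) to the continuation k.
Query : ℕ → Set
Query n = Σ (Subset n × Subset n) (λ AB → ValidQuery (proj₁ AB) (proj₂ AB))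

answer : ∀ {n} → Graph n → Maybe (Query n) → Bool
answer G nothing               = false
answer G (just ((A , B) , _)) = bis G A B

askOne : ∀ {n} → Maybe (Query n) → (Bool → QTree n) → QTree n
askOne nothing               k = k false
askOne (just ((A , B) , _)) k = ask A B k

batch : ∀ {n N} → (Fin N → Maybe (Query n)) → (Vec Bool N → QTree n) → QTree n
batch {N = zero}  q k = k []
batch {N = suc N} q k = askOne (q F.zero) (λ b → batch (λ i → q (F.suc i)) (λ v → k (b ∷ v)))

answers : ∀ {n N} → Graph n → (Fin N → Maybe (Query n)) → Vec Bool N
answers {N = zero}  G q = []
answers {N = suc N} G q = answer G (q F.zero) ∷ answers G (λ i → q (F.suc i))

lookup-answers : ∀ {n N} (G : Graph n) (q : Fin N → Maybe (Query n)) x →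
                 lookup (answers G q) x ≡ answer G (q x)
lookup-answers G q F.zero    = refl
lookup-answers G q (F.suc x) = lookup-answers G (λ i → q (F.suc i)) x

run-batch : ∀ {n N} (G : Graph n) (q : Fin N → Maybe (Query n)) k →
            run G (batch q k) ≡ run G (k (answers G q))
run-batch {N = zero}  G q k = refl
run-batch {N = suc N} G q k with q F.zero
... | nothing = run-batch G (λ i → q (F.suc i)) (λ v → k (false ∷ v))
... | just ((A , B) , _) = run-batch G (λ i → q (F.suc i)) (λ v → k (bis G A B ∷ v))

queries-batch : ∀ {n N} (G : Graph n) (q : Fin N → Maybe (Query n)) (k : Vec Bool N → Bool) →
                queries G (batch q (λ v → leaf (k v))) ≤ N
queries-batch {N = zero}  G q k = z≤n
queries-batch {N = suc N} G q k with q F.zero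
... | nothing = m≤n⇒m≤1+n (queries-batch G (λ i → q (F.suc i)) (λ v → k (false ∷ v)))
... | just ((A , B) , _) = s≤s (queries-batch G (λ i → q (F.suc i)) (λ v → k (bis G A B ∷ v)))

valid-batch : ∀ {n N} (q : Fin N → Maybe (Query n)) k → (∀ v → ValidTree (k v)) →
              ValidTree (batch q k)
valid-batch {N = zero}  q k h = h []
valid-batch {N = suc N} q k h with q F.zero
... | nothing = valid-batch (λ i → q (F.suc i)) _ (λ v → h (false ∷ v))
... | just ((A , B) , AB-valid) =
  ask A B _ AB-valid (λ b → valid-batch (λ i → q (F.suc i)) _ (λ v → h (b ∷ v)))

class : ∀ {n m} → (Fin n → Fin m) → Fin m → Subset n
class h a = tabulate (λ v → h v == a)

∈class⁻ : ∀ {n m} (h : Fin n → Fin m) {a v} → v ∈ class h a → h v ≡ a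
∈class⁻ h {a} {v} v∈ = ==-sound (trans (sym (lookup∘tabulate (λ v → h v == a) v)) ([]=⇒lookup v∈))

∈class⁺ : ∀ {n m} (h : Fin n → Fin m) v → v ∈ class h (h v)
∈class⁺ h v = lookup⇒[]= v _ (trans (lookup∘tabulate (λ w → h w == h v) v) (==-refl (h v)))

classQuery : ∀ {n m} → (Fin n → Fin m) → Fin m → Fin m → Maybe (Query n)
classQuery h a b with a F.≟ b | nonempty? (class h a) | nonempty? (class h b)
... | no a≢b | yes a-inhabited | yes b-inhabited =
  just ((class h a , class h b) , a-inhabited , b-inhabited ,
        λ v v∈a v∈b → a≢b (trans (sym (∈class⁻ h v∈a)) (∈class⁻ h v∈b)))
... | _ | _ | _ = nothing

compressed : ∀ {n m} → Graph n → (Fin n → Fin m) → Fin m → Fin m → Bool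
compressed G h a b = answer G (classQuery h a b)

compressed-sound : ∀ {n m} (G : Graph n) (h : Fin n → Fin m) a b → compressed G h a b ≡ true →
                   ∃ λ u → ∃ λ v → h u ≡ a × h v ≡ b × Edge G u v
compressed-sound G h a b e with a F.≟ b | nonempty? (class h a) | nonempty? (class h b)
... | no _ | yes _ | yes _ with bis-sound G _ _ e
...   | u , v , u∈a , v∈b , uv = u , v , ∈class⁻ h u∈a , ∈class⁻ h v∈b , uv

compressed-complete : ∀ {n m} (G : Graph n) (h : Fin n → Fin m) u v → Edge G u v →
                      ¬ h u ≡ h v → compressed G h (h u) (h v) ≡ true
compressed-complete G h u v uv hu≢hv
  with h u F.≟ h v | nonempty? (class h (h u)) | nonempty? (class h (h v))
... | yes hu≡hv | _ | _ = ⊥-elim (hu≢hv hu≡hv)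
... | no _ | yes _ | yes _ = bis-complete G _ _ u v (∈class⁺ h u) (∈class⁺ h v) uv
... | no _ | yes _ | no empty = ⊥-elim (empty (v , ∈class⁺ h v))
... | no _ | no empty | _ = ⊥-elim (empty (u , ∈class⁺ h u))

cover-compresses : ∀ {n m} (G : Graph n) (h : Fin n → Fin m) k →
                   HasVCAtMost G k → HasCover (compressed G h) k
cover-compresses G h k (S , ∣S∣≤k , S-covers) =
  image colour S , ≤-trans (∣image∣ colour S) ∣S∣≤k , covers
  where
  colour = λ u → just (h u)
  covers : ∀ a b → compressed G h a b ≡ true → a ∈ image colour S ⊎ b ∈ image colour S
  covers a b e with compressed-sound G h a b e
  ... | u , v , hu≡a , hv≡b , uv with S-covers u v uv
  ...   | inj₁ u∈S = inj₁ (∈image colour S u∈S (cong just hu≡a))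
  ...   | inj₂ v∈S = inj₂ (∈image colour S v∈S (cong just hv≡b))

find-success : ∀ {A : Set} {P : A → Set} (P? : Decidable P) xs {x} → x ∈L xs → P x →
               ∃ λ w → find P? xs ≡ just w × w ∈L xs × P w
find-success P? (y ∷ xs) x∈ px with P? y
... | yes py = y , refl , here refl , py
... | no ¬py with x∈
...   | here refl = ⊥-elim (¬py px)
...   | there x∈xs with find-success P? xs x∈xs px
...     | w , found , w∈ , pw = w , found , there w∈ , pw

-- Conversely, if the colouring is injective on a certificate W, a small cover
-- of the compressed graph pulls back (through a partial inverse of h on W) to a
-- small cover of the edges inside W, hence to a small vertex cover of G.
cover-lifts : ∀ {n m} (G : Graph n) (h : Fin n → Fin m) k W → Certificate G k W →
              (∀ {u v} → u ∈L W → v ∈L W → h u ≡ h v → u ≡ v) →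
              HasCover (compressed G h) k → HasVCAtMost G k
cover-lifts {n} G h k W certificate injective (Θ , ∣Θ∣≤k , Θ-covers) =
  certificate (image representative Θ) (≤-trans (∣image∣ representative Θ) ∣Θ∣≤k) covers
  where
  representative : _ → Maybe (Fin n)
  representative a = find (λ w → h w F.≟ a) W
  pulled-back : ∀ {u} → u ∈L W → h u ∈ Θ → u ∈ image representative Θ
  pulled-back {u} u∈W hu∈Θ with find-success (λ w → h w F.≟ h u) W u∈W refl
  ... | w , found , w∈W , hw≡hu =
    ∈image representative Θ hu∈Θ (trans found (cong just (injective w∈W u∈W hw≡hu)))
  covers : CoversInside G W (image representative Θ)
  covers u v u∈W v∈W uv with Θ-covers (h u) (h v) (compressed-complete G h u v uv hu≢hv)
    where
    hu≢hv : ¬ h u ≡ h v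
    hu≢hv hu≡hv with refl ← injective u∈W v∈W hu≡hv with () ← trans (sym (noLoop G u)) uv
  ... | inj₁ hu∈Θ = inj₁ (pulled-back u∈W hu∈Θ)
  ... | inj₂ hv∈Θ = inj₂ (pulled-back v∈W hv∈Θ)

colours : ℕ → ℕ
colours k = 256 * k ^ 4

-- Kept opaque so that the typechecker never unfolds the well-founded recursion of ⌊log₂_⌋.
opaque
  rounds : ℕ → ℕ
  rounds k = ⌊log₂ k ⌋

  rounds≡ : ∀ k → rounds k ≡ ⌊log₂ k ⌋
  rounds≡ k = refl

colourings : ℕ → ℕ → ℕ
colourings n k = colours k ^ n

seedCount : ℕ → ℕ → ℕ
seedCount n k = colourings n k ^ rounds k

colouring : ∀ n k → Fin (seedCount n k) → Fin (rounds k) → Fin n → Fin (colours k)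
colouring n k i t = finToFun {colours k} {n} (finToFun {colourings n k} {rounds k} i t)

QueryIndex : ℕ → ℕ
QueryIndex k = rounds k * (colours k * colours k)

index : ∀ k → Fin (rounds k) → Fin (colours k) → Fin (colours k) → Fin (QueryIndex k)
index k t a b = combine t (combine a b)

pairQuery : ∀ n k → Fin (seedCount n k) → Fin (rounds k) → Fin (colours k * colours k) → Maybe (Query n)
pairQuery n k i t ab = classQuery (colouring n k i t) (proj₁ (remQuot {colours k} (colours k) ab))
                                                      (proj₂ (remQuot {colours k} (colours k) ab))

plan : ∀ n k → Fin (seedCount n k) → Fin (QueryIndex k) → Maybe (Query n)
plan n k i x = pairQuery n k i (proj₁ (remQuot {rounds k} (colours k * colours k) x))
                               (proj₂ (remQuot {rounds k} (colours k * colours k) x))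

plan-index : ∀ n k i t a b → plan n k i (index k t a b) ≡ classQuery (colouring n k i t) a b
plan-index n k i t a b =
  trans (cong (λ p → pairQuery n k i (proj₁ p) (proj₂ p)) (remQuot-combine t (combine a b)))
        (cong (λ p → classQuery (colouring n k i t) (proj₁ p) (proj₂ p)) (remQuot-combine a b))

roundGraph : ∀ k → Vec Bool (QueryIndex k) → Fin (rounds k) → Fin (colours k) → Fin (colours k) → Bool
roundGraph k replies t a b = lookup replies (index k t a b)

accept : ∀ k → Vec Bool (QueryIndex k) → Bool
accept k replies = everyFin (λ t → does (cover? (roundGraph k replies t) k))

algorithm : RandAlg
algorithm = record
  { seeds = seedCount
  ; tree  = λ n k i → batch (plan n k i) (λ replies → leaf (accept k replies))
  }

algorithm-valid : ∀ n k i → ValidTree (tree algorithm n k i)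
algorithm-valid n k i = valid-batch (plan n k i) _ (λ replies → leaf (accept k replies))

algorithm-queries : ∀ n k (G : Graph n) i → queries G (tree algorithm n k i) ≤ 65536 * k ^ 8 * ⌊log₂ k ⌋
algorithm-queries n k G i =
  ≤-trans (queries-batch G (plan n k i) (accept k))
          (≤-reflexive (trans (total (rounds k) k) (cong (65536 * k ^ 8 *_) (rounds≡ k))))
  where
  total : ∀ r k → r * (256 * k ^ 4 * (256 * k ^ 4)) ≡ 65536 * k ^ 8 * r
  total = solve 2 (λ r k → r :* (con 256 :* k :^ 4 :* (con 256 :* k :^ 4)) := con 65536 :* k :^ 8 :* r) refl

observed : ∀ n k (G : Graph n) i t a b →
           roundGraph k (answers G (plan n k i)) t a b ≡ compressed G (colouring n k i t) a b
observed n k G i t a b = trans (lookup-answers G (plan n k i) (index k t a b))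
                               (cong (answer G) (plan-index n k i t a b))

seed-correct : ∀ n k (G : Graph n) W → Certificate G k W → ∀ i t →
               (∀ {u v} → u ∈L W → v ∈L W → colouring n k i t u ≡ colouring n k i t v → u ≡ v) →
               Correct G k (tree algorithm n k i)
seed-correct n k G W certificate i t injective = mk⇔ accepted⇒cover cover⇒accepted
  where
  result : run G (tree algorithm n k i) ≡ accept k (answers G (plan n k i))
  result = run-batch G (plan n k i) (λ replies → leaf (accept k replies))

  accepted⇒cover : run G (tree algorithm n k i) ≡ true → HasVCAtMost G k
  accepted⇒cover accepted =
    cover-lifts G (colouring n k i t) k W certificate injective
      (HasCover-cong k (observed n k G i t)
        (witness (cover? _ k) (everyFin-sound _ (trans (sym result) accepted) t)))

  cover⇒accepted : HasVCAtMost G k → run G (tree algorithm n k i) ≡ true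
  cover⇒accepted vc = trans result (everyFin-complete _ λ t′ →
    dec-true (cover? _ k)
      (HasCover-cong k (λ a b → sym (observed n k G i t′ a b)) (cover-compresses G (colouring n k i t′) k vc)))

collides : ∀ {n m} → List (Fin n) → (Fin n → Fin m) → Bool
collides W h = any (λ u → any (λ v → not (u == v) ∧ (h u == h v)) W) W

no-collision⇒injective : ∀ {n m} W (h : Fin n → Fin m) → collides W h ≡ false →
                         ∀ {u v} → u ∈L W → v ∈L W → h u ≡ h v → u ≡ v
no-collision⇒injective W h none {u} {v} u∈W v∈W hu≡hv
  with u F.≟ v | any-false _ W (any-false _ W none u∈W) v∈W
... | yes u≡v | _       = u≡v
... | no _    | pair-ok
  with () ← trans (sym (subst (λ c → (h u == c) ≡ true) hu≡hv (==-refl (h u)))) pair-ok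

-- Union bound over all pairs of W, each pair colliding for a 1/m fraction of colourings.
collision-count : ∀ m n (W : List (Fin n)) →
  count {m ^ n} (λ j → collides W (finToFun j)) * m ≤ length W * (length W * m ^ n)
collision-count m n W =
  union-bound W (λ u j → any (λ v → pair-collides u v j) W) m _
    (λ u → union-bound W (pair-collides u) m _ (pair-count u))
  where
  pair-collides : Fin n → Fin n → Fin (m ^ n) → Bool
  pair-collides u v j = not (u == v) ∧ (finToFun j u == finToFun j v)
  pair-count : ∀ u v → count (pair-collides u v) * m ≤ m ^ n
  pair-count u v with u F.≟ v
  ... | yes _   = ≤-trans (≤-reflexive (cong (_* m) (count-false {m ^ n}))) z≤n
  ... | no u≢v = ≤-reflexive (collisions m n u≢v)

rare-collisions : ∀ m n (W : List (Fin n)) .{{_ : NonZero m}} → 4 * (length W * length W) ≤ m →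
                  count {m ^ n} (λ j → collides W (finToFun j)) * 4 ≤ m ^ n
rare-collisions m n W fits = *-cancelʳ-≤ _ _ m (begin
    bad * 4 * m                              ≡⟨ shuffle bad m ⟩
    4 * (bad * m)                            ≤⟨ *-monoʳ-≤ 4 (collision-count m n W) ⟩
    4 * (length W * (length W * m ^ n))      ≡⟨ regroup (length W) (m ^ n) ⟩
    4 * (length W * length W) * m ^ n        ≤⟨ *-monoˡ-≤ (m ^ n) fits ⟩
    m * m ^ n                                ≡⟨ *-comm m (m ^ n) ⟩
    m ^ n * m                                ∎)
  where
  open ≤-Reasoning
  bad = count {m ^ n} (λ j → collides W (finToFun j))
  shuffle : ∀ c m → c * 4 * m ≡ 4 * (c * m)
  shuffle = solve 2 (λ c m → c :* con 4 :* m := con 4 :* (c :* m)) refl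
  regroup : ∀ L M → 4 * (L * (L * M)) ≡ 4 * (L * L) * M
  regroup = solve 2 (λ L M → con 4 :* (L :* (L :* M)) := con 4 :* (L :* L) :* M) refl

certificate-fits : ∀ k L → 1 ≤ k → L ≤ 2 * (suc k * suc k) → 4 * (L * L) ≤ 256 * k ^ 4
certificate-fits k L 1≤k L≤ = begin
    4 * (L * L)                                       ≤⟨ *-monoʳ-≤ 4 (*-mono-≤ L≤8k² L≤8k²) ⟩
    4 * (2 * (2 * k * (2 * k)) * (2 * (2 * k * (2 * k)))) ≡⟨ expand k ⟩
    256 * k ^ 4                                       ∎
  where
  open ≤-Reasoning
  1+k≤2k : suc k ≤ 2 * k
  1+k≤2k = begin
    suc k      ≡⟨ +-comm 1 k ⟩
    k + 1      ≤⟨ +-monoʳ-≤ k 1≤k ⟩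
    k + k      ≡⟨ cong (k +_) (sym (+-identityʳ k)) ⟩
    2 * k      ∎
  L≤8k² : L ≤ 2 * (2 * k * (2 * k))
  L≤8k² = ≤-trans L≤ (*-monoʳ-≤ 2 (*-mono-≤ 1+k≤2k 1+k≤2k))
  expand : ∀ k → 4 * (2 * (2 * k * (2 * k)) * (2 * (2 * k * (2 * k)))) ≡ 256 * k ^ 4
  expand = solve 1 (λ k → con 4 :* (con 2 :* (con 2 :* k :* (con 2 :* k)) :* (con 2 :* (con 2 :* k :* (con 2 :* k))))
                      := con 256 :* k :^ 4) refl

^-distribʳ-* : ∀ a b r → (a * b) ^ r ≡ a ^ r * b ^ r
^-distribʳ-* a b zero    = refl
^-distribʳ-* a b (suc r) = trans (cong (a * b *_) (^-distribʳ-* a b r)) (interchange a b (a ^ r) (b ^ r))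
  where
  interchange : ∀ a b x y → a * b * (x * y) ≡ a * x * (b * y)
  interchange = solve 4 (λ a b x y → a :* b :* (x :* y) := a :* x :* (b :* y)) refl

amplification : ∀ M r (bad : Fin M → Bool) → count bad * 4 ≤ M →
  (M ^ r ∸ count (λ i → not (everyFin (λ t → bad (finToFun {M} {r} i t))))) * 4 ^ r ≤ M ^ r
amplification M r bad quarter = begin
    (M ^ r ∸ count good) * 4 ^ r               ≡⟨ cong (_* 4 ^ r) all-bad ⟩
    count bad ^ r * 4 ^ r                      ≡⟨ sym (^-distribʳ-* (count bad) 4 r) ⟩
    (count bad * 4) ^ r                        ≤⟨ ^-monoˡ-≤ r quarter ⟩
    M ^ r                                      ∎
  where
  open ≤-Reasoning
  every-bad good : Fin (M ^ r) → Bool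
  every-bad i = everyFin (λ t → bad (finToFun {M} {r} i t))
  good i = not (every-bad i)
  all-bad : M ^ r ∸ count good ≡ count bad ^ r
  all-bad = begin-equality
    M ^ r ∸ count good                          ≡⟨ cong (_∸ count good) (sym (count-not good)) ⟩
    count good + count (λ i → not (good i)) ∸ count good  ≡⟨ m+n∸m≡n (count good) _ ⟩
    count (λ i → not (not (every-bad i)))       ≡⟨ sumFin-cong (λ i → cong toN (not-involutive (every-bad i))) ⟩
    count every-bad                             ≡⟨ count-every M r bad ⟩
    count bad ^ r                               ∎

k<2^[1+⌊log₂k⌋] : ∀ k → k < 2 ^ suc ⌊log₂ k ⌋
k<2^[1+⌊log₂k⌋] k with k <? 2 ^ suc ⌊log₂ k ⌋
... | yes k< = k<
... | no  k≮ = contradiction (⌊log₂⌋-mono-≤ (≮⇒≥ k≮)) log-too-big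
  where
  log-too-big : ¬ (⌊log₂ (2 ^ suc ⌊log₂ k ⌋) ⌋ ≤ ⌊log₂ k ⌋)
  log-too-big rewrite ⌊log₂[2^n]⌋≡n (suc ⌊log₂ k ⌋) = n≮n ⌊log₂ k ⌋

-- ⌊log₂ k⌋ rounds push the failure probability 4 ^ -⌊log₂ k⌋ below 1/k.
k≤4^⌊log₂k⌋ : ∀ k → k ≤ 4 ^ ⌊log₂ k ⌋
k≤4^⌊log₂k⌋ k with ⌊log₂ k ⌋ | k<2^[1+⌊log₂k⌋] k
... | zero  | k<2       = ≤-pred k<2
... | suc r | k<2^[2+r] = ≤-trans (<⇒≤ k<2^[2+r]) (2^[2+r]≤4^[1+r] r)
  where
  2^[2+r]≤4^[1+r] : ∀ r → 2 ^ suc (suc r) ≤ 4 ^ suc r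
  2^[2+r]≤4^[1+r] zero    = ≤-refl
  2^[2+r]≤4^[1+r] (suc r) = *-mono-≤ {2} {4} (s≤s (s≤s z≤n)) (2^[2+r]≤4^[1+r] r)

1≤power : ∀ {a} e → 1 ≤ a → 1 ≤ a ^ e
1≤power {a} e 1≤a = subst (_≤ a ^ e) (^-zeroˡ e) (^-monoˡ-≤ e 1≤a)

module GoodSeeds (n k : ℕ) (G : Graph n) (W : List (Fin n)) (certificate : Certificate G k W) where

  collidesOn : Fin (colourings n k) → Bool
  collidesOn j = collides W (finToFun j)

  roundCollides : Fin (seedCount n k) → Fin (rounds k) → Bool
  roundCollides i t = collidesOn (finToFun {colourings n k} {rounds k} i t)

  goodSeed : Fin (seedCount n k) → Bool
  goodSeed i = not (everyFin (roundCollides i))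

  good : Subset (seedCount n k)
  good = tabulate goodSeed

  good-correct : ∀ i → i ∈ good → Correct G k (tree algorithm n k i)
  good-correct i i∈good =
    seed-correct n k G W certificate i t (no-collision⇒injective W (colouring n k i t) no-collision)
    where
    i-good : goodSeed i ≡ true
    i-good = trans (sym (lookup∘tabulate goodSeed i)) ([]=⇒lookup i∈good)
    t = proj₁ (everyFin-false (roundCollides i) (not-injective {y = false} i-good))
    no-collision = proj₂ (everyFin-false (roundCollides i) (not-injective {y = false} i-good))

  few-bad : 1 ≤ k → length W ≤ 2 * (suc k * suc k) → (seedCount n k ∸ ∣ good ∣) * k ≤ seedCount n k
  few-bad 1≤k ∣W∣≤ = begin
    (seedCount n k ∸ ∣ good ∣) * k                 ≡⟨ cong (λ c → (seedCount n k ∸ c) * k) (∣tabulate∣ goodSeed) ⟩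
    (seedCount n k ∸ count goodSeed) * k           ≤⟨ *-monoʳ-≤ (seedCount n k ∸ count goodSeed) (subst (λ r → k ≤ 4 ^ r) (sym (rounds≡ k)) (k≤4^⌊log₂k⌋ k)) ⟩
    (seedCount n k ∸ count goodSeed) * 4 ^ rounds k ≤⟨ amplification (colourings n k) (rounds k) collidesOn quarter ⟩
    seedCount n k                                  ∎
    where
    open ≤-Reasoning
    instance
      colours-nonZero : NonZero (colours k)
      colours-nonZero = >-nonZero (*-mono-≤ {1} {256} (s≤s z≤n) (1≤power 4 1≤k))
    quarter : count collidesOn * 4 ≤ colourings n k
    quarter = rare-collisions (colours k) n W (certificate-fits k (length W) 1≤k ∣W∣≤)

seeds-positive : ∀ n k → 1 ≤ k → 1 ≤ seedCount n k
seeds-positive n k 1≤k = 1≤power (rounds k) (1≤power n (*-mono-≤ {1} {256} (s≤s z≤n) (1≤power 4 1≤k)))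

good-seeds : ∀ n k → 1 ≤ k → (G : Graph n) → ∃[ good ]
  ((∀ i → i ∈ good → Correct G k (tree algorithm n k i))
  × (seedCount n k ∸ ∣ good ∣) ^ 1 * k ^ 1 ≤ seedCount n k ^ 1)
good-seeds n k 1≤k G = from-certificate (kernel G k)
  where
  from-certificate : ∃[ W ] (length W ≤ 2 * (suc k * suc k) × Certificate G k W) → ∃[ good ]
    ((∀ i → i ∈ good → Correct G k (tree algorithm n k i))
    × (seedCount n k ∸ ∣ good ∣) ^ 1 * k ^ 1 ≤ seedCount n k ^ 1)
  from-certificate (W , ∣W∣≤ , certificate) =
    good , good-correct , first-powers (seedCount n k ∸ ∣ good ∣) k (seedCount n k) (few-bad 1≤k ∣W∣≤)
    where
    open GoodSeeds n k G W certificate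
    first-powers : ∀ a b c → a * b ≤ c → a ^ 1 * b ^ 1 ≤ c ^ 1
    first-powers a b c rewrite ^-identityʳ a | ^-identityʳ b | ^-identityʳ c = λ ab≤c → ab≤c

theorem3 : ∃[ 𝒜 ]
    ((∀ n k i → ValidTree (tree 𝒜 n k i))
    × (∃[ C ] ∃[ k₀ ] (∀ n k → k₀ ≤ k → (G : Graph n) → ∀ i →
          queries G (tree 𝒜 n k i) ≤ C * k ^ 8 * ⌊log₂ k ⌋))
    × (∃[ a ] ∃[ b ] (1 ≤ a × 1 ≤ b × (∀ n k → 1 ≤ k →
          1 ≤ seeds 𝒜 n k × ((G : Graph n) → ∃[ good ]
            ((∀ i → i ∈ good → Correct G k (tree 𝒜 n k i))
            × (seeds 𝒜 n k ∸ ∣ good ∣) ^ b * k ^ a ≤ seeds 𝒜 n k ^ b))))))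
theorem3 =
  algorithm ,
  algorithm-valid ,
  (65536 , 0 , λ n k _ G i → algorithm-queries n k G i) ,
  (1 , 1 , ≤-refl , ≤-refl , λ n k 1≤k → seeds-positive n k 1≤k , good-seeds n k 1≤k)
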